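{- Let $\mathcal{G}=(\mathcal{V},\mathit{Act},\mathcal{R})$ be a normed BPA system with no silent variables, and let $\alpha,\beta,\gamma,\delta\in\mathcal{V}^*$, $X\in\mathcal{V}$. Then: (1) if $\gamma\sim\delta$, then $\sim_\gamma\,=\,\sim_\delta$, $\|\cdot\|_{\mathrm{cc},\gamma}=\|\cdot\|_{\mathrm{cc},\delta}$, and $\mathrm{Red}(\gamma)=\mathrm{Red}(\delta)$; (2) if $\alpha\sim_\gamma\beta$, then $\|\alpha\|_{\mathrm{cc},\gamma}=\|\beta\|_{\mathrm{cc},\gamma}$; (3) $\|\alpha\beta\|_{\mathrm{cc},\gamma}=\|\alpha\|_{\mathrm{cc},\beta\gamma}+\|\beta\|_{\mathrm{cc},\gamma}$; (4) $\alpha\gamma\sim\gamma$ iff $\alpha\in(\mathrm{Red}(\gamma))^*$ iff $\|\alpha\|_{\mathrm{cc},\gamma}=0$; in particular, $X\in\mathrm{Red}(\gamma)$ iff $\|X\|_{\mathrm{cc},\gamma}=0$.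
   Context: Branching bisimulation on an LTS (with silent action $\tau$): a symmetric relation $\mathcal{B}$ such that for every $(s,t)\in\mathcal{B}$ and $s\xrightarrow{a}s'$, either $a=\tau$ and $(s',t)\in\mathcal{B}$, or there are $k\ge0$ and $t=t_0\xrightarrow{\tau}\cdots\xrightarrow{\tau}t_k\xrightarrow{a}t'$ with $(s',t')\in\mathcal{B}$ and $(s,t_i)\in\mathcal{B}$ for $1\le i\le k$; $\sim$ is the union of all branching bisimulations. A BPA system $\mathcal{G}=(\mathcal{V},\mathit{Act},\mathcal{R})$: finite variables $\mathcal{V}$, finite actions $\mathit{Act}$ (possibly containing $\tau$), finite rules $A\xrightarrow{a}\alpha$ with $A\in\mathcal{V},\alpha\in\mathcal{V}^*$; its LTS has states $\mathcal{V}^*$ and transitions $A\beta\xrightarrow{a}\alpha\beta$ for each rule and each $\beta$; normed means every variable $A$ has $A\xrightarrow{w}\varepsilon$ for some $w$. A variable $A$ is silent if $A\xrightarrow{w}\alpha$ implies $w\in\{\tau\}^*$. A transition $\alpha\xrightarrow{a}\beta$ is class-changing if $\alpha\not\sim\beta$; the cc-length of a path is its number of class-changing transitions; $\|\alpha\|_{\mathrm{cc}}$ is the minimum cc-length of a path $\alpha\xrightarrow{w}\varepsilon$. $\mathrm{Red}(\beta)=\{X\in\mathcal{V}\mid X\beta\sim\beta\}$. For $\gamma\in\mathcal{V}^*$: $\alpha\sim_\gamma\beta$ iff $\alpha\gamma\sim\beta\gamma$, and $\|\alpha\|_{\mathrm{cc},\gamma}=\|\alpha\gamma\|_{\mathrm{cc}}-\|\gamma\|_{\mathrm{cc}}$.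 -}

module Defs where

open import Level using (Level) renaming (suc to lsuc; zero to lzero)
open import Data.Nat using (ℕ; zero; suc; _≤_)
open import Data.Integer as ℤ using (ℤ; +_; _-_)
open import Data.Fin using (Fin)
open import Data.Maybe using (Maybe; nothing; just)
open import Data.List using (List; []; _∷_; _++_)
open import Data.List.Membership.Propositional using (_∈_)
open import Data.List.Relation.Unary.All using (All)
open import Data.Product using (Σ; _×_; _,_; ∃)
open import Data.Sum using (_⊎_)
open import Relation.Nullary using (¬_)
open import Relation.Binary.PropositionalEquality using (_≡_)

-- Actions: 'nothing' is the silent action τ, 'just i' are visible actions.
Action : ℕ → Set
Action nA = Maybe (Fin nA)

τ : ∀ {nA} → Action nA
τ = nothing

record BPA : Set where
  field
    nV    : ℕ
    nA    : ℕ
    rules : List (Fin nV × Action nA × List (Fin nV))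

module BPADefs (G : BPA) where
  open BPA G

  Var : Set
  Var = Fin nV

  Act : Set
  Act = Action nA

  Word : Set
  Word = List Var

  data Step : Word → Act → Word → Set where
    step : ∀ {A a α} β → (A , a , α) ∈ rules → Step (A ∷ β) a (α ++ β)

  data Steps : Word → List Act → Word → Set where
    [] : ∀ {α} → Steps α [] α
    _∷_ : ∀ {α a β w γ} → Step α a β → Steps β w γ → Steps α (a ∷ w) γ

  Normed : Set
  Normed = ∀ (A : Var) → Σ (List Act) λ w → Steps (A ∷ []) w []

  Silent : Var → Set
  Silent A = ∀ w α → Steps (A ∷ []) w α → All (_≡ τ) w

  NoSilentVariables : Set
  NoSilentVariables = ∀ (A : Var) → ¬ Silent A

  Rel : Set₁
  Rel = Word → Word → Set

  -- TauSeq R s t u :  t = t₀ --τ--> t₁ --τ--> ... --τ--> t_k = u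
  -- with (s , t_i) ∈ R for 1 ≤ i ≤ k
  data TauSeq (R : Rel) (s : Word) : Word → Word → Set where
    here  : ∀ {t} → TauSeq R s t t
    there : ∀ {t t₁ u} → Step t τ t₁ → R s t₁ → TauSeq R s t₁ u → TauSeq R s t u

  IsBranchingBisimulation : Rel → Set
  IsBranchingBisimulation R =
    (∀ {s t} → R s t → R t s) ×
    (∀ {s t a s′} → R s t → Step s a s′ →
       (a ≡ τ × R s′ t) ⊎
       Σ Word λ tk → Σ Word λ t′ →
         TauSeq R s t tk × Step tk a t′ × R s′ t′)

  _∼_ : Word → Word → Set₁
  s ∼ t = Σ Rel λ R → IsBranchingBisimulation R × R s t

  -- CCPath α n : a path α --w--> ε whose cc-length (number of
  -- class-changing transitions) is n
  data CCPath : Word → ℕ → Set₁ where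
    done   : CCPath [] 0
    keep   : ∀ {α a β n} → Step α a β → α ∼ β → CCPath β n → CCPath α n
    change : ∀ {α a β n} → Step α a β → ¬ (α ∼ β) → CCPath β n → CCPath α (suc n)

  CCNorm : Word → ℕ → Set₁
  CCNorm α n = CCPath α n × (∀ m → CCPath α m → n ≤ m)

  -- ‖α‖cc,γ = k  where  ‖α‖cc,γ = ‖αγ‖cc − ‖γ‖cc  (computed in ℤ)
  CCNormRel : Word → Word → ℤ → Set₁
  CCNormRel α γ k = Σ ℕ λ a → Σ ℕ λ b →
    CCNorm (α ++ γ) a × CCNorm γ b × k ≡ (+ a) - (+ b)

  _∼[_]_ : Word → Word → Word → Set₁
  α ∼[ γ ] β = (α ++ γ) ∼ (β ++ γ)

  Red : Word → Var → Set₁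
  Red β X = (X ∷ β) ∼ β

-- Branching bisimilarity ∼ is an equivalence and a left congruence for
-- sequential composition, and bisimilar states can simulate each other's
-- paths to ε without increasing the number of class-changing steps; so
-- ‖·‖cc is ∼-invariant, which gives (1)–(3). For (4), if αγ ∼ γ then
-- simulating a path of γ from αργ and cutting it at ργ and at γ shows that
-- either ργ ∼ γ or γ has a path with strictly fewer steps; well-founded
-- induction therefore yields ργ ∼ γ for every suffix ρ of α. Conversely a
-- cc-minimal path of αγ passes through γ, so ‖α‖cc,γ = 0 forces the prefix
-- up to γ to stay inside one ∼-class.
module Submission where

open import Defs
open import Data.Integer using (ℤ; _+_; 0ℤ)
open import Data.List using (List; []; _∷_; _++_)
open import Data.List.Relation.Unary.All using (All)
open import Data.Product using (_×_)
open import Function.Bundles using (_⇔_)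
open import Relation.Binary.PropositionalEquality using (_≡_)

open import Data.Nat as ℕ using (ℕ; zero; suc; _≤_; _<_; z≤n; s≤s)
open import Data.Nat.Induction using (<-rec)
import Data.Nat.Properties as ℕₚ
open import Data.Integer using (+_; _-_)
open import Data.Integer.Properties using (i≡j⇒i-j≡0; i-j≡0⇒i≡j)
open import Data.Integer.Tactic.RingSolver using (solve-∀)
open import Data.List using (length)
open import Data.List.Properties using (++-assoc)
open import Data.List.Relation.Unary.All using ([]; _∷_)
open import Data.Product using (∃; ∃₂; _,_; proj₁; proj₂)
open import Data.Sum using (_⊎_; inj₁; inj₂)
open import Data.Empty using (⊥-elim)
open import Data.Unit.Polymorphic using (⊤; tt)
open import Relation.Nullary using (¬_)
open import Relation.Binary.PropositionalEquality using (refl; sym; cong; cong₂; subst)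
open import Function.Bundles using (mk⇔)

module Bisimilarity (G : BPA) where
  open BPADefs G

  Matches : Rel → Word → Word → Act → Word → Set
  Matches R s t a s′ =
    (a ≡ τ × R s′ t) ⊎ ∃₂ λ tk t′ → TauSeq R s t tk × Step tk a t′ × R s′ t′

  bisimilar : ∀ {R s t} → IsBranchingBisimulation R → R s t → s ∼ t
  bisimilar R-bb r = _ , R-bb , r

  Matches-map : ∀ {R S : Rel} → (∀ {x y} → R x y → S x y) →
                ∀ {s t a s′} → Matches R s t a s′ → Matches S s t a s′
  Matches-map f (inj₁ (a≡τ , r)) = inj₁ (a≡τ , f r)
  Matches-map f (inj₂ (tk , t′ , seq , st , r)) = inj₂ (tk , t′ , TauSeq-map f seq , st , f r)
    where
    TauSeq-map : ∀ {R S : Rel} → (∀ {x y} → R x y → S x y) →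
                 ∀ {s t tk} → TauSeq R s t tk → TauSeq S s t tk
    TauSeq-map f here = here
    TauSeq-map f (there st r seq) = there st (f r) (TauSeq-map f seq)

  TauSeq-++ : ∀ {R s t tm tk} → TauSeq R s t tm → TauSeq R s tm tk → TauSeq R s t tk
  TauSeq-++ here seq′ = seq′
  TauSeq-++ (there st r seq) seq′ = there st r (TauSeq-++ seq seq′)

  TauSeq-relatesEnd : ∀ {R s t tk} → R s t → TauSeq R s t tk → R s tk
  TauSeq-relatesEnd r here = r
  TauSeq-relatesEnd _ (there _ r seq) = TauSeq-relatesEnd r seq

  TauSeq-unsnoc : ∀ {R s t tk} → TauSeq R s t tk →
                  t ≡ tk ⊎ ∃ λ tl → TauSeq R s t tl × Step tl τ tk
  TauSeq-unsnoc here = inj₁ refl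
  TauSeq-unsnoc (there st r seq) with TauSeq-unsnoc seq
  ... | inj₁ refl = inj₂ (_ , here , st)
  ... | inj₂ (tl , seq′ , st′) = inj₂ (tl , there st r seq′ , st′)

  ≡-isBranchingBisimulation : IsBranchingBisimulation _≡_
  ≡-isBranchingBisimulation = sym , λ { refl st → inj₂ (_ , _ , here , st , refl) }

  ∼-refl : ∀ {s} → s ∼ s
  ∼-refl = bisimilar ≡-isBranchingBisimulation refl

  ∼-sym : ∀ {s t} → s ∼ t → t ∼ s
  ∼-sym (R , R-bb , r) = R , R-bb , proj₁ R-bb r

  _⨾_ : Rel → Rel → Rel
  (R ⨾ S) s t = ∃ λ u → R s u × S u t

  module Composition {R S : Rel}
    (R-bb : IsBranchingBisimulation R) (S-bb : IsBranchingBisimulation S) where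

    TauSeq-⨾ : ∀ {s u t tk} → R s u → TauSeq S u t tk → TauSeq (R ⨾ S) s t tk
    TauSeq-⨾ _ here = here
    TauSeq-⨾ rsu (there st sut₁ seq) = there st (_ , rsu , sut₁) (TauSeq-⨾ rsu seq)

    simulateTauSeq : ∀ {s u t uk} → R s u → S u t → TauSeq R s u uk →
                     ∃ λ tm → TauSeq (R ⨾ S) s t tm × S uk tm
    simulateTauSeq _ sut here = _ , here , sut
    simulateTauSeq rsu sut (there st rsu₁ seq) with proj₂ S-bb sut st
    ... | inj₁ (_ , su₁t) = simulateTauSeq rsu₁ su₁t seq
    ... | inj₂ (_ , _ , seqₜ , stₜ , su₁t₁) with simulateTauSeq rsu₁ su₁t₁ seq
    ...   | tm , seq′ , sukm =
            tm , TauSeq-++ (TauSeq-⨾ rsu seqₜ) (there stₜ (_ , rsu₁ , su₁t₁) seq′) , sukm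

    -- When the last step of u is answered by t standing still, the last
    -- τ-step of t's simulating sequence takes its place.
    matchFinalStep : ∀ {s t a s′ u′ tm uk} → R s′ u′ → TauSeq (R ⨾ S) s t tm → R s uk →
                     Matches S uk tm a u′ → Matches (R ⨾ S) s t a s′
    matchFinalStep rs′u′ seq _ (inj₁ (refl , su′tm)) with TauSeq-unsnoc seq
    ... | inj₁ refl = inj₁ (refl , _ , rs′u′ , su′tm)
    ... | inj₂ (tl , seq′ , st) = inj₂ (tl , _ , seq′ , st , _ , rs′u′ , su′tm)
    matchFinalStep rs′u′ seq rsuk (inj₂ (tk , t′ , seqₜ , st , su′t′)) =
      inj₂ (tk , t′ , TauSeq-++ seq (TauSeq-⨾ rsuk seqₜ) , st , _ , rs′u′ , su′t′)

    ⨾-matches : ∀ {s t a s′} → (R ⨾ S) s t → Step s a s′ → Matches (R ⨾ S) s t a s′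
    ⨾-matches (u , rsu , sut) st with proj₂ R-bb rsu st
    ... | inj₁ (a≡τ , rs′u) = inj₁ (a≡τ , u , rs′u , sut)
    ... | inj₂ (_ , _ , seq , st′ , rs′u′) with simulateTauSeq rsu sut seq
    ...   | _ , seq′ , sukm =
            matchFinalStep rs′u′ seq′ (TauSeq-relatesEnd rsu seq) (proj₂ S-bb sukm st′)

  _⨾⊎⨾_ : Rel → Rel → Rel
  (R ⨾⊎⨾ S) s t = (R ⨾ S) s t ⊎ (S ⨾ R) s t

  ⨾⊎⨾-isBranchingBisimulation : ∀ {R S} → IsBranchingBisimulation R → IsBranchingBisimulation S →
                               IsBranchingBisimulation (R ⨾⊎⨾ S)
  ⨾⊎⨾-isBranchingBisimulation {R} {S} R-bb S-bb = symmetric , matches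
    where
    symmetric : ∀ {s t} → (R ⨾⊎⨾ S) s t → (R ⨾⊎⨾ S) t s
    symmetric (inj₁ (u , rsu , sut)) = inj₂ (u , proj₁ S-bb sut , proj₁ R-bb rsu)
    symmetric (inj₂ (u , sut , rsu)) = inj₁ (u , proj₁ R-bb rsu , proj₁ S-bb sut)
    matches : ∀ {s t a s′} → (R ⨾⊎⨾ S) s t → Step s a s′ → Matches (R ⨾⊎⨾ S) s t a s′
    matches (inj₁ c) st = Matches-map inj₁ (Composition.⨾-matches R-bb S-bb c st)
    matches (inj₂ c) st = Matches-map inj₂ (Composition.⨾-matches S-bb R-bb c st)

  ∼-trans : ∀ {s u t} → s ∼ u → u ∼ t → s ∼ t
  ∼-trans (R , R-bb , r) (S , S-bb , s) =
    _ , ⨾⊎⨾-isBranchingBisimulation R-bb S-bb , inj₁ (_ , r , s)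

  ≁-resp-∼ : ∀ {s s′ t t′} → ¬ (s ∼ s′) → s ∼ t → s′ ∼ t′ → ¬ (t ∼ t′)
  ≁-resp-∼ s≁s′ s∼t s′∼t′ t∼t′ = s≁s′ (∼-trans s∼t (∼-trans t∼t′ (∼-sym s′∼t′)))

  -- Only the first variable of a word can move, so a common prefix is
  -- matched step for step.
  Prefixed : Rel → Rel
  Prefixed R s t = ∃₂ λ α γ → ∃ λ δ → s ≡ α ++ γ × t ≡ α ++ δ × R γ δ

  Prefixed-isBranchingBisimulation : ∀ {R} → IsBranchingBisimulation R →
                                     IsBranchingBisimulation (Prefixed R)
  Prefixed-isBranchingBisimulation {R} R-bb = symmetric , matches
    where
    symmetric : ∀ {s t} → Prefixed R s t → Prefixed R t s
    symmetric (α , γ , δ , s≡ , t≡ , r) = α , δ , γ , t≡ , s≡ , proj₁ R-bb r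
    unprefixed : ∀ {γ δ} → R γ δ → Prefixed R γ δ
    unprefixed r = [] , _ , _ , refl , refl , r
    matches : ∀ {s t a s′} → Prefixed R s t → Step s a s′ → Matches (Prefixed R) s t a s′
    matches ([] , _ , _ , refl , refl , r) st = Matches-map unprefixed (proj₂ R-bb r st)
    matches ((_ ∷ α) , γ , δ , refl , refl , r) (step {α = ρ} _ rule) =
      inj₂ (_ , _ , here , step (α ++ δ) rule ,
            ρ ++ α , γ , δ , sym (++-assoc ρ α γ) , sym (++-assoc ρ α δ) , r)

  ∼-++⁺ˡ : ∀ α {γ δ} → γ ∼ δ → (α ++ γ) ∼ (α ++ δ)
  ∼-++⁺ˡ α (R , R-bb , r) =
    _ , Prefixed-isBranchingBisimulation R-bb , (α , _ , _ , refl , refl , r)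

  ∼[]-resp-∼ : ∀ {α β γ δ} → γ ∼ δ → α ∼[ γ ] β → α ∼[ δ ] β
  ∼[]-resp-∼ {α} {β} γ∼δ αγ∼βγ = ∼-trans (∼-++⁺ˡ α (∼-sym γ∼δ)) (∼-trans αγ∼βγ (∼-++⁺ˡ β γ∼δ))

module CCNorms (G : BPA) (normed : BPADefs.Normed G) where
  open BPADefs G
  open Bisimilarity G

  Step-++ʳ : ∀ {α a α′} β → Step α a α′ → Step (α ++ β) a (α′ ++ β)
  Step-++ʳ β (step {α = ρ} β₀ rule) =
    subst (Step _ _) (sym (++-assoc ρ β₀ β)) (step (β₀ ++ β) rule)

  Steps-++ʳ : ∀ {α w α′} β → Steps α w α′ → Steps (α ++ β) w (α′ ++ β)
  Steps-++ʳ β [] = []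
  Steps-++ʳ β (st ∷ sts) = Step-++ʳ β st ∷ Steps-++ʳ β sts

  Steps-++ : ∀ {α w β w′ γ} → Steps α w β → Steps β w′ γ → Steps α (w ++ w′) γ
  Steps-++ [] sts′ = sts′
  Steps-++ (st ∷ sts) sts′ = st ∷ Steps-++ sts sts′

  pathToε : ∀ α → ∃ λ w → Steps α w []
  pathToε [] = [] , []
  pathToε (A ∷ α) with normed A | pathToε α
  ... | w , A→ε | w′ , α→ε = w ++ w′ , Steps-++ (Steps-++ʳ α A→ε) α→ε

  module Marked (C : Word → Word → Set₁) where
    data Path : Word → ℕ → Word → Set₁ where
      end  : ∀ {α} → Path α 0 α
      stay : ∀ {α a β n γ} → Step α a β → α ∼ β → Path β n γ → Path α n γ
      mark : ∀ {α a β n γ} → Step α a β → C α β → Path β n γ → Path α (suc n) γ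

    unmarked⇒∼ : ∀ {α β} → Path α 0 β → α ∼ β
    unmarked⇒∼ end = ∼-refl
    unmarked⇒∼ (stay _ α∼β p) = ∼-trans α∼β (unmarked⇒∼ p)

    -- Each word on a path to ε still ends with β until the prefix α is used up.
    splitAt : ∀ α β {s n} → s ≡ α ++ β → Path s n [] →
              ∃₂ λ n₁ n₂ → n ≡ n₁ ℕ.+ n₂ × Path s n₁ β × Path β n₂ []
    splitAt [] β refl p = 0 , _ , refl , end , p
    splitAt (_ ∷ α) β () end
    splitAt (_ ∷ α) β refl (stay (step {α = ρ} _ rule) e p)
      with splitAt (ρ ++ α) β (sym (++-assoc ρ α β)) p
    ... | n₁ , n₂ , n≡ , p₁ , p₂ = n₁ , n₂ , n≡ , stay (step _ rule) e p₁ , p₂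
    splitAt (_ ∷ α) β refl (mark (step {α = ρ} _ rule) c p)
      with splitAt (ρ ++ α) β (sym (++-assoc ρ α β)) p
    ... | n₁ , n₂ , n≡ , p₁ , p₂ = suc n₁ , n₂ , cong₂ ℕ._+_ refl n≡ , mark (step _ rule) c p₁ , p₂

    -- ε has no moves, so every step of a state related to ε is answered by standing still.
    unmarkedPathToε : ∀ {R t w} → IsBranchingBisimulation R → R t [] → Steps t w [] → Path t 0 []
    unmarkedPathToε R-bb r [] = end
    unmarkedPathToε R-bb r (st ∷ sts) with proj₂ R-bb r st
    ... | inj₁ (_ , r′) =
          stay st (∼-trans (bisimilar R-bb r) (∼-sym (bisimilar R-bb r′)))
                  (unmarkedPathToε R-bb r′ sts)
    ... | inj₂ (_ , _ , here , () , _)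
    ... | inj₂ (_ , _ , there () _ _ , _ , _)

    module Transfer (C-resp : ∀ {s s′ t t′} → C s s′ → s ∼ t → s′ ∼ t′ → C t t′) where

      TauSeq-prepend : ∀ {R s t tk n γ} → IsBranchingBisimulation R → R s t → TauSeq R s t tk →
                       Path tk n γ → Path t n γ
      TauSeq-prepend R-bb r here p = p
      TauSeq-prepend R-bb r (there st r₁ seq) p =
        stay st (∼-trans (∼-sym (bisimilar R-bb r)) (bisimilar R-bb r₁))
                (TauSeq-prepend R-bb r₁ seq p)

      transfer : ∀ {R s t n} → IsBranchingBisimulation R → R s t → Path s n [] →
                 ∃ λ m → m ≤ n × Path t m []
      transfer R-bb r end =
        0 , z≤n , unmarkedPathToε R-bb (proj₁ R-bb r) (proj₂ (pathToε _))
      transfer R-bb r (stay st s∼s′ p) with proj₂ R-bb r st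
      ... | inj₁ (_ , r′) = transfer R-bb r′ p
      ... | inj₂ (_ , _ , seq , st′ , r′) with transfer R-bb r′ p
      ...   | m , m≤n , q = m , m≤n , TauSeq-prepend R-bb r seq (stay st′ tk∼t′ q)
        where
        tk∼t′ = ∼-trans (∼-sym (bisimilar R-bb (TauSeq-relatesEnd r seq)))
                        (∼-trans s∼s′ (bisimilar R-bb r′))
      transfer R-bb r (mark st c p) with proj₂ R-bb r st
      ... | inj₁ (_ , r′) with transfer R-bb r′ p
      ...   | m , m≤n , q = m , ℕₚ.m≤n⇒m≤1+n m≤n , q
      transfer R-bb r (mark st c p) | inj₂ (_ , _ , seq , st′ , r′) with transfer R-bb r′ p
      ...   | m , m≤n , q = suc m , s≤s m≤n , TauSeq-prepend R-bb r seq (mark st′ c′ q)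
        where
        c′ = C-resp c (bisimilar R-bb (TauSeq-relatesEnd r seq)) (bisimilar R-bb r′)

  module CC = Marked (λ α β → ¬ (α ∼ β))
  -- Any step may be marked here, so every word has such a path to ε without deciding ∼.
  module Counted = Marked (λ _ _ → ⊤)

  fromCCPath : ∀ {α n} → CCPath α n → CC.Path α n []
  fromCCPath done = CC.end
  fromCCPath (keep st e p) = CC.stay st e (fromCCPath p)
  fromCCPath (change st c p) = CC.mark st c (fromCCPath p)

  toCCPath : ∀ {α n} → CC.Path α n [] → CCPath α n
  toCCPath CC.end = done
  toCCPath (CC.stay st e p) = keep st e (toCCPath p)
  toCCPath (CC.mark st c p) = change st c (toCCPath p)

  ccNorm-mono : ∀ {s t a b} → s ∼ t → CCNorm s a → CCNorm t b → b ≤ a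
  ccNorm-mono (_ , R-bb , r) (pa , _) (_ , b-min)
    with CC.Transfer.transfer ≁-resp-∼ R-bb r (fromCCPath pa)
  ... | m , m≤a , q = ℕₚ.≤-trans (b-min m (toCCPath q)) m≤a

  ccNorm-resp-∼ : ∀ {s t a b} → s ∼ t → CCNorm s a → CCNorm t b → a ≡ b
  ccNorm-resp-∼ s∼t na nb = ℕₚ.≤-antisym (ccNorm-mono (∼-sym s∼t) nb na) (ccNorm-mono s∼t na nb)

  ccNorm-unique : ∀ {s a b} → CCNorm s a → CCNorm s b → a ≡ b
  ccNorm-unique = ccNorm-resp-∼ ∼-refl

  ccNormRel-resp-∼ : ∀ {α β γ δ k l} → (α ++ γ) ∼ (β ++ δ) → γ ∼ δ →
                     CCNormRel α γ k → CCNormRel β δ l → k ≡ l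
  ccNormRel-resp-∼ αγ∼βδ γ∼δ (_ , _ , na , nb , refl) (_ , _ , na′ , nb′ , refl) =
    cong₂ (λ a b → + a - + b) (ccNorm-resp-∼ αγ∼βδ na na′) (ccNorm-resp-∼ γ∼δ nb nb′)

  ccNormRel-++ : ∀ α β γ {k l m} →
                 CCNormRel (α ++ β) γ k → CCNormRel α (β ++ γ) l → CCNormRel β γ m → k ≡ l + m
  ccNormRel-++ α β γ (a , c , αβγ , γ₁ , refl) (a′ , b , αβγ′ , βγ , refl)
                     (b′ , c′ , βγ′ , γ₂ , refl)
    rewrite ccNorm-unique (subst (λ w → CCNorm w a) (++-assoc α β γ) αβγ) αβγ′
          | ccNorm-unique βγ βγ′
          | ccNorm-unique γ₁ γ₂
          = telescope (+ a′) (+ b′) (+ c′)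
    where
    telescope : ∀ (i j k : ℤ) → i - k ≡ (i - j) + (j - k)
    telescope = solve-∀

  absorbed-suffix : ∀ α ρ γ → (α ++ ρ ++ γ) ∼ γ → (ρ ++ γ) ∼ γ
  absorbed-suffix α ρ γ (R , R-bb , r) = <-rec P shorten _ (allMarked (proj₂ (pathToε γ)))
    where
    P : ℕ → Set₁
    P n = Counted.Path γ n [] → (ρ ++ γ) ∼ γ
    allMarked : ∀ {t w} → Steps t w [] → Counted.Path t (length w) []
    allMarked [] = Counted.end
    allMarked (st ∷ sts) = Counted.mark st tt (allMarked sts)
    shorten : ∀ n → (∀ {m} → m < n → P m) → P n
    shorten n rec p with Counted.Transfer.transfer (λ _ _ _ → tt) R-bb (proj₁ R-bb r) p
    ... | m , m≤n , q with Counted.splitAt α (ρ ++ γ) refl q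
    ... | n₁ , m₂ , refl , _ , q₂ with Counted.splitAt ρ γ refl q₂
    ... | zero  , _  , _    , ρ→γ , _  = Counted.unmarked⇒∼ ρ→γ
    ... | suc k , n₃ , refl , _   , q₃ =
          rec (ℕₚ.≤-trans (s≤s (ℕₚ.m≤n+m n₃ k)) (ℕₚ.≤-trans (ℕₚ.m≤n+m _ n₁) m≤n)) q₃

  absorbed⇒All-Red : ∀ α {γ} → (α ++ γ) ∼ γ → All (Red γ) α
  absorbed⇒All-Red [] _ = []
  absorbed⇒All-Red (X ∷ ρ) {γ} Xργ∼γ =
    ∼-trans (∼-++⁺ˡ (X ∷ []) (∼-sym ργ∼γ)) Xργ∼γ ∷ absorbed⇒All-Red ρ ργ∼γ
    where
    ργ∼γ = absorbed-suffix (X ∷ []) ρ γ Xργ∼γ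

  All-Red⇒absorbed : ∀ α {γ} → All (Red γ) α → (α ++ γ) ∼ γ
  All-Red⇒absorbed [] [] = ∼-refl
  All-Red⇒absorbed (X ∷ α) (red ∷ reds) = ∼-trans (∼-++⁺ˡ (X ∷ []) (All-Red⇒absorbed α reds)) red

  absorbed⇒ccNormRel≡0 : ∀ {α γ k} → CCNormRel α γ k → (α ++ γ) ∼ γ → k ≡ 0ℤ
  absorbed⇒ccNormRel≡0 (_ , _ , na , nb , refl) αγ∼γ =
    i≡j⇒i-j≡0 (cong +_ (ccNorm-resp-∼ αγ∼γ na nb))

  ccNormRel≡0⇒absorbed : ∀ {α γ k} → CCNormRel α γ k → k ≡ 0ℤ → (α ++ γ) ∼ γ
  ccNormRel≡0⇒absorbed {α} {γ} (a , b , (pa , _) , (_ , b-min) , refl) k≡0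
    with i-j≡0⇒i≡j (+ a) (+ b) k≡0
  ... | refl with CC.splitAt α γ refl (fromCCPath pa)
  ... | zero , _ , _ , αγ→γ , _ = CC.unmarked⇒∼ αγ→γ
  ... | suc n₁ , n₂ , refl , _ , γ→ε = ⊥-elim (ℕₚ.m+n≮n n₁ n₂ (b-min n₂ (toCCPath γ→ε)))

proposition5 : (G : BPA) → let open BPADefs G in
    Normed → NoSilentVariables →
    (∀ (γ δ : Word) → γ ∼ δ →
      (∀ α β → (α ∼[ γ ] β) ⇔ (α ∼[ δ ] β))
      × (∀ α (k l : ℤ) → CCNormRel α γ k → CCNormRel α δ l → k ≡ l)
      × (∀ X → Red γ X ⇔ Red δ X))
    × (∀ (α β γ : Word) → α ∼[ γ ] β →
      ∀ (k l : ℤ) → CCNormRel α γ k → CCNormRel β γ l → k ≡ l)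
    × (∀ (α β γ : Word) (k l m : ℤ) →
      CCNormRel (α ++ β) γ k → CCNormRel α (β ++ γ) l → CCNormRel β γ m →
      k ≡ l + m)
    × (∀ (α γ : Word) →
      ((α ++ γ) ∼ γ ⇔ All (Red γ) α)
      × (∀ (k : ℤ) → CCNormRel α γ k → ((α ++ γ) ∼ γ ⇔ k ≡ 0ℤ)))
    × (∀ (X : Var) (γ : Word) →
      ∀ (k : ℤ) → CCNormRel (X ∷ []) γ k → (Red γ X ⇔ k ≡ 0ℤ))
proposition5 G normed _ =
    (λ γ δ γ∼δ →
        (λ α β → mk⇔ (∼[]-resp-∼ γ∼δ) (∼[]-resp-∼ (∼-sym γ∼δ)))
      , (λ α k l → ccNormRel-resp-∼ (∼-++⁺ˡ α γ∼δ) γ∼δ)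
      , (λ X → mk⇔ (∼[]-resp-∼ γ∼δ) (∼[]-resp-∼ (∼-sym γ∼δ))))
  , (λ α β γ αγ∼βγ k l → ccNormRel-resp-∼ αγ∼βγ ∼-refl)
  , (λ α β γ k l m → ccNormRel-++ α β γ)
  , (λ α γ → mk⇔ (absorbed⇒All-Red α) (All-Red⇒absorbed α)
           , λ k ‖α‖ → mk⇔ (absorbed⇒ccNormRel≡0 ‖α‖) (ccNormRel≡0⇒absorbed ‖α‖))
  , (λ X γ k ‖X‖ → mk⇔ (absorbed⇒ccNormRel≡0 ‖X‖) (ccNormRel≡0⇒absorbed ‖X‖))
  where
  open BPADefs G
  open Bisimilarity G
  open CCNorms G normed
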